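{- Let $F$ be a graph. There is a constant $C$ depending only on $F$ such that the following holds: if $\mathcal{H}$ is an $F$-free hypergraph on $n$ vertices in which every hyperedge has size at least $|V(F)|$, then $$\sum_{v \in V(\mathcal{H})} d(v) = \sum_{h\in\mathcal{H}}|h| \le C n^2 .$$ Furthermore, for every integer $r\ge 3$ there exist a constant $c>0$ and, for arbitrarily large $N$, $K_r$-free hypergraphs $\mathcal{H}$ on $N$ vertices in which every hyperedge has size exactly $r$ and $$\sum_{v \in V(\mathcal{H})} d(v) \ge c N^2 .$$
   Context: Hypergraphs are finite and may contain multiple copies of the same hyperedge (multi-hyperedges); a hypergraph is viewed as a family of hyperedges, and $d(v)$ is the number of hyperedges containing $v$. For a graph $G$, a hypergraph $\mathcal{B}$ is a Berge-$G$ if there is a bijection $f:E(G)\to E(\mathcal{B})$ with $e\subseteq f(e)$ for every $e\in E(G)$ (where the vertices of $G$ are identified with distinct vertices of the hypergraph). A hypergraph $\mathcal{H}$ contains $G$ if some subfamily of its hyperedges is a Berge-$G$; $\mathcal{H}$ is $G$-free if it does not contain $G$. $K_r$ is the complete graph on $r$ vertices. -}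

module Defs where

open import Data.Nat using (ℕ; _≤_; _*_; _^_; suc)
open import Data.Fin using (Fin; _<_; _≟_)
open import Data.Fin.Subset using (Subset; _∈_; ∣_∣)
open import Data.List using (List; length; lookup; map)
open import Data.Nat.ListAction using (sum)
open import Data.Empty using (⊥)
open import Data.Bool using (Bool; T; not; true; false)
open import Data.Product using (Σ; _×_; ∃)
open import Relation.Nullary.Decidable using (⌊_⌋)
open import Relation.Binary.PropositionalEquality using (_≡_)
open import Function.Definitions using (Injective)

record Graph : Set where
  field
    vertices : ℕ
    adj      : Fin vertices → Fin vertices → Bool
    adj-sym  : ∀ i j → adj i j ≡ adj j i
    adj-irr  : ∀ i → adj i i ≡ false
open Graph public

-- The edges of G: each edge {i,j} is represented once, as a pair i < j.
Edge : Graph → Set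
Edge G = Σ (Fin (vertices G)) λ i → Σ (Fin (vertices G)) λ j → (i < j) × T (adj G i j)

-- A hypergraph on vertex set Fin n: a finite family (list, so multi-hyperedges
-- are allowed) of hyperedges, each a subset of Fin n.
Hypergraph : ℕ → Set
Hypergraph n = List (Subset n)

-- H contains G: there are an injective identification of the vertices of G
-- with vertices of H and an injective map from E(G) to (indices of) hyperedges
-- of H such that each edge is contained in its image hyperedge.  The image of
-- this injective map is the subfamily that is a Berge-G.
Contains : ∀ {n} → Hypergraph n → Graph → Set
Contains {n} H G =
  Σ (Fin (vertices G) → Fin n) λ φ →
  Σ (Edge G → Fin (length H)) λ f →
    Injective _≡_ _≡_ φ ×
    Injective _≡_ _≡_ f ×
    (∀ (e : Edge G) → let (i Data.Product., j Data.Product., _) = e in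
        (φ i ∈ lookup H (f e)) × (φ j ∈ lookup H (f e)))

Free : ∀ {n} → Hypergraph n → Graph → Set
Free H G = Contains H G → ⊥

totalSize : ∀ {n} → Hypergraph n → ℕ
totalSize H = sum (map ∣_∣ H)

K : ℕ → Graph
K r = record
  { vertices = r
  ; adj      = λ i j → not ⌊ i ≟ j ⌋
  ; adj-sym  = sym'
  ; adj-irr  = irr
  }
  where
  open import Relation.Nullary using (yes; no)
  open import Relation.Binary.PropositionalEquality using (refl; sym)
  sym' : ∀ (i j : Fin r) → not ⌊ i ≟ j ⌋ ≡ not ⌊ j ≟ i ⌋
  sym' i j with i ≟ j | j ≟ i
  ... | yes _ | yes _ = refl
  ... | no _  | no _  = refl
  ... | yes p | no q  = Data.Empty.⊥-elim (q (sym p)) where import Data.Empty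
  ... | no p  | yes q = Data.Empty.⊥-elim (p (sym q)) where import Data.Empty
  irr : ∀ (i : Fin r) → not ⌊ i ≟ i ⌋ ≡ false
  irr i with i ≟ i
  ... | yes _ = refl
  ... | no p  = Data.Empty.⊥-elim (p refl) where import Data.Empty

-- Let k = |V(F)| and call two distinct vertices light if fewer
-- than k² hyperedges contain both.  If k vertices were pairwise heavy, greedily
-- giving the edges of F distinct hyperedges would yield a Berge-F
-- (containsFromHeavySet).  So in an F-free H every set of k vertices has a
-- light pair; deleting one end of it repeatedly shows |h| ≤ (k+1)·λ(h), where
-- λ(h) counts the ordered light pairs inside h.  Double counting
-- (pairWeight-sum) bounds Σ_h λ(h) by n² light pairs of codegree < k².
--
-- For r = d + 1 ≥ 3 the star-block hypergraph on the r × m grid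
-- has a hyperedge {(0 , a)} ∪ {(s , j) : s > 0} for every (a , j): m² edges of
-- size r, total size N²/r for N = rm.  A Berge-K_r has at most one vertex in
-- row 0; with none, its r vertices share a column of only d rows, and with one,
-- its links to two further vertices would be the same hyperedge.
module Submission where

open import Defs
open import Data.Nat using (ℕ; _≤_; _*_; _^_; suc)
open import Data.Fin.Subset using (∣_∣)
open import Data.List.Relation.Unary.All using (All)
open import Data.Product using (Σ; _×_; ∃)
open import Relation.Binary.PropositionalEquality using (_≡_)

open import Data.Nat using (zero; _+_; _<_; z≤n; s≤s; _<?_; _≤?_)
open import Data.Nat.Properties
open import Data.Fin as Fin using (Fin; zero; suc; combine; remQuot)
import Data.Fin.Properties as Finₚ
open import Data.Fin.Subset using (Subset; inside; outside; _∈_; _∉_; _-_; ⁅_⁆; Nonempty)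
open import Data.Fin.Subset.Properties using (_∈?_; p─⊥≡p; p─q⊆p; x∈p⇒∣p-x∣<∣p∣; ∣⁅x⁆∣≡1; x∈⁅y⁆⇒x≡y)
open import Data.Vec as Vec using ([]; _∷_; here; there)
open import Data.Vec.Properties using (lookup-concat; lookup∘tabulate; lookup⇒[]=; []=⇒lookup)
open import Data.List as List using (List; length; []; _∷_)
open import Data.Nat.ListAction using (sum)
open import Data.List.Relation.Unary.All as All using ([]; _∷_)
open import Data.List.Relation.Unary.All.Properties using (tabulate⁺)
open import Data.List.Properties using (length-tabulate; lookup-tabulate)
open import Data.Nat.Tactic.RingSolver using (solve-∀)
open import Data.Product using (_,_; proj₁; proj₂)
import Data.Product as Product
open import Data.Bool.Properties using (T-irrelevant)
open import Data.Empty using (⊥)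
open import Data.Sum using (_⊎_; inj₁; inj₂; [_,_]′)
open import Data.Unit using (tt)
open import Data.Bool using (T)
open import Relation.Binary.Definitions using (tri<; tri≈; tri>)
open import Function using (_∘_; Injective)
open import Relation.Binary.PropositionalEquality using (refl; sym; trans; cong; cong₂; subst; _≢_; module ≡-Reasoning)
import Relation.Nullary.Decidable as Dec
open import Relation.Nullary using (Dec; yes; no; contradiction; _×-dec_; ¬?)
open import Relation.Unary using (Decidable)
open import Algebra.Properties.CommutativeMonoid.Sum +-0-commutativeMonoid
  renaming (sum to ∑) using (∑-distrib-+; sum-cong-≗; sum-replicate-zero)

𝟙 : ∀ {P : Set} → Dec P → ℕ
𝟙 (yes _) = 1
𝟙 (no _)  = 0

𝟙-mono : ∀ {P Q : Set} (p? : Dec P) (q? : Dec Q) → (P → Q) → 𝟙 p? ≤ 𝟙 q?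
𝟙-mono (yes p) (yes _) _   = ≤-refl
𝟙-mono (yes p) (no ¬q) p⇒q = contradiction (p⇒q p) ¬q
𝟙-mono (no _)  _       _   = z≤n

∑-mono : ∀ {n} {f g : Fin n → ℕ} → (∀ i → f i ≤ g i) → ∑ f ≤ ∑ g
∑-mono {zero}  _   = z≤n
∑-mono {suc n} f≤g = +-mono-≤ (f≤g zero) (∑-mono (f≤g ∘ suc))

∑-mono-< : ∀ {n} {f g : Fin n → ℕ} → (∀ i → f i ≤ g i) → ∀ i → f i < g i → ∑ f < ∑ g
∑-mono-< f≤g zero    f<g = +-mono-<-≤ f<g (∑-mono (f≤g ∘ suc))
∑-mono-< f≤g (suc i) f<g = +-mono-≤-< (f≤g zero) (∑-mono-< (f≤g ∘ suc) i f<g)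

∑-bound : ∀ {n} {f : Fin n → ℕ} c → (∀ i → f i ≤ c) → ∑ f ≤ n * c
∑-bound {zero}  _ _   = z≤n
∑-bound {suc n} c f≤c = +-mono-≤ (f≤c zero) (∑-bound c (f≤c ∘ suc))

∑-zero : ∀ {n} {f : Fin n → ℕ} → (∀ i → f i ≡ 0) → ∑ f ≡ 0
∑-zero {n} f≡0 = trans (sum-cong-≗ f≡0) (sum-replicate-zero n)

x∉p-x : ∀ {n} (p : Subset n) x → x ∉ p - x
x∉p-x (_ ∷ p) zero    ()
x∉p-x (_ ∷ p) (suc x) (there x∈p-x) = x∉p-x p x x∈p-x

∣p∣≤1+∣p-x∣ : ∀ {n} (p : Subset n) x → ∣ p ∣ ≤ suc ∣ p - x ∣
∣p∣≤1+∣p-x∣ (inside  ∷ p) zero    = s≤s (≤-reflexive (cong ∣_∣ (sym (p─⊥≡p p))))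
∣p∣≤1+∣p-x∣ (outside ∷ p) zero    = m≤n⇒m≤1+n (≤-reflexive (cong ∣_∣ (sym (p─⊥≡p p))))
∣p∣≤1+∣p-x∣ (inside  ∷ p) (suc x) = s≤s (∣p∣≤1+∣p-x∣ p x)
∣p∣≤1+∣p-x∣ (outside ∷ p) (suc x) = ∣p∣≤1+∣p-x∣ p x

nonempty : ∀ {n} (p : Subset n) → 1 ≤ ∣ p ∣ → Nonempty p
nonempty (inside  ∷ p) _  = zero , here
nonempty (outside ∷ p) 1≤ = Product.map suc there (nonempty p 1≤)

chooseElements : ∀ {n} (p : Subset n) k → k ≤ ∣ p ∣ →
  Σ (Fin k → Fin n) λ φ → Injective _≡_ _≡_ φ × (∀ i → φ i ∈ p)
chooseElements p zero _ = (λ ()) , (λ {}) , (λ ())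
chooseElements (outside ∷ p) k k≤ =
  let (φ , φ-inj , φ∈p) = chooseElements p k k≤ in
  suc ∘ φ , φ-inj ∘ Finₚ.suc-injective , there ∘ φ∈p
chooseElements {suc n} (inside ∷ p) (suc k) (s≤s k≤) = φ′ , φ′-inj , φ′∈p
  where
  rest : Σ (Fin k → Fin n) λ φ → Injective _≡_ _≡_ φ × (∀ i → φ i ∈ p)
  rest = chooseElements p k k≤
  φ′ : Fin (suc k) → Fin (suc n)
  φ′ zero    = zero
  φ′ (suc i) = suc (proj₁ rest i)
  φ′-inj : Injective _≡_ _≡_ φ′
  φ′-inj {zero}  {zero}  _ = refl
  φ′-inj {suc i} {suc j} e = cong suc (proj₁ (proj₂ rest) (Finₚ.suc-injective e))
  φ′∈p : ∀ i → φ′ i ∈ inside ∷ p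
  φ′∈p zero    = here
  φ′∈p (suc i) = there (proj₂ (proj₂ rest) i)

record Representatives {K L} (P : Fin K → Subset L) (Active : Fin K → Set) : Set where
  field
    pick     : ∀ c → Active c → Fin L
    pick∈    : ∀ c a → pick c a ∈ P c
    distinct : ∀ {c c′} a a′ → pick c a ≡ pick c′ a′ → c ≡ c′

greedy : ∀ K {L} (P : Fin K → Subset L) {Active : Fin K → Set} → Decidable Active →
  (∀ c → Active c → K ≤ ∣ P c ∣) → Representatives P Active
greedy zero P _ _ = record { pick = λ () ; pick∈ = λ () ; distinct = λ { {()} } }
greedy (suc K) {L} P {Active} active? enough with active? zero
... | no inactive = record { pick = pick′ ; pick∈ = pick∈′ ; distinct = distinct′ }
  where
  open Representatives (greedy K (P ∘ suc) (active? ∘ suc)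
                          (λ c a → ≤-trans (n≤1+n K) (enough (suc c) a)))
  pick′ : ∀ c → Active c → Fin L
  pick′ zero    a = contradiction a inactive
  pick′ (suc c) a = pick c a
  pick∈′ : ∀ c a → pick′ c a ∈ P c
  pick∈′ zero    a = contradiction a inactive
  pick∈′ (suc c) a = pick∈ c a
  distinct′ : ∀ {c c′} a a′ → pick′ c a ≡ pick′ c′ a′ → c ≡ c′
  distinct′ {zero}  a _  _ = contradiction a inactive
  distinct′ {suc _} {zero} _ a′ _ = contradiction a′ inactive
  distinct′ {suc _} {suc _} a a′ e = cong suc (distinct a a′ e)
... | yes a₀ = record { pick = pick′ ; pick∈ = pick∈′ ; distinct = distinct′ }
  where
  first : Nonempty (P zero)
  first = nonempty (P zero) (≤-trans (s≤s z≤n) (enough zero a₀))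
  x₀ : Fin L
  x₀ = proj₁ first
  open Representatives (greedy K (λ c → P (suc c) - x₀) (active? ∘ suc)
                          (λ c a → ≤-pred (≤-trans (enough (suc c) a) (∣p∣≤1+∣p-x∣ (P (suc c)) x₀))))
  pick′ : ∀ c → Active c → Fin L
  pick′ zero    _ = x₀
  pick′ (suc c) a = pick c a
  pick∈′ : ∀ c a → pick′ c a ∈ P c
  pick∈′ zero    _ = proj₂ first
  pick∈′ (suc c) a = p─q⊆p _ _ (pick∈ c a)
  x₀-unpicked : ∀ c a → x₀ ≢ pick c a
  x₀-unpicked c a e = x∉p-x (P (suc c)) x₀ (subst (_∈ P (suc c) - x₀) (sym e) (pick∈ c a))
  distinct′ : ∀ {c c′} a a′ → pick′ c a ≡ pick′ c′ a′ → c ≡ c′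
  distinct′ {zero}  {zero}   _ _  _ = refl
  distinct′ {zero}  {suc c′} _ a′ e = contradiction e (x₀-unpicked c′ a′)
  distinct′ {suc c} {zero}   a _  e = contradiction (sym e) (x₀-unpicked c a)
  distinct′ {suc _} {suc _}  a a′ e = cong suc (distinct a a′ e)

BothIn : ∀ {n} → Subset n → Fin n → Fin n → Set
BothIn h u v = u ∈ h × v ∈ h

bothIn? : ∀ {n} (h : Subset n) u v → Dec (BothIn h u v)
bothIn? h u v = (u ∈? h) ×-dec (v ∈? h)

hits : ∀ {n} (H : Hypergraph n) → Fin n → Fin n → Subset (length H)
hits []      u v = []
hits (h ∷ H) u v = Dec.does (bothIn? h u v) ∷ hits H u v

codegree : ∀ {n} → Hypergraph n → Fin n → Fin n → ℕ
codegree H u v = ∣ hits H u v ∣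

∣does∷p∣ : ∀ {P : Set} {n} (d : Dec P) (p : Subset n) → ∣ Dec.does d ∷ p ∣ ≡ 𝟙 d + ∣ p ∣
∣does∷p∣ (yes _) p = refl
∣does∷p∣ (no _)  p = refl

zero∈does∷p : ∀ {P : Set} {n} (d : Dec P) {p : Subset n} → zero ∈ Dec.does d ∷ p → P
zero∈does∷p (yes prf) _ = prf

hits-sound : ∀ {n} (H : Hypergraph n) {u v} x → x ∈ hits H u v → BothIn (List.lookup H x) u v
hits-sound (h ∷ H) {u} {v} zero    x∈         = zero∈does∷p (bothIn? h u v) x∈
hits-sound (h ∷ H)         (suc x) (there x∈) = hits-sound H x x∈

edge-≡ : ∀ {G} (e e′ : Edge G) → proj₁ e ≡ proj₁ e′ → proj₁ (proj₂ e) ≡ proj₁ (proj₂ e′) → e ≡ e′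
edge-≡ (i , j , i<j , ij) (_ , _ , i<j′ , ij′) refl refl
  rewrite Finₚ.<-irrelevant i<j i<j′ | T-irrelevant ij ij′ = refl

containsFromHeavySet : (F : Graph) {n : ℕ} (H : Hypergraph n) (s : Subset n) →
  vertices F ≤ ∣ s ∣ →
  (∀ {u v} → u ∈ s → v ∈ s → u ≢ v → vertices F * vertices F ≤ codegree H u v) →
  Contains H F
containsFromHeavySet F {n} H s k≤∣s∣ heavy = φ , f , φ-inj , f-inj , f-covers
  where
  k : ℕ
  k = vertices F
  chosen : Σ (Fin k → Fin n) λ φ → Injective _≡_ _≡_ φ × (∀ i → φ i ∈ s)
  chosen = chooseElements s k k≤∣s∣
  φ : Fin k → Fin n
  φ = proj₁ chosen
  φ-inj : Injective _≡_ _≡_ φ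
  φ-inj = proj₁ (proj₂ chosen)
  -- request c = (i , j) asks for a hyperedge through φ i and φ j; only i < j is served
  Ordered : Fin k × Fin k → Set
  Ordered (i , j) = i Fin.< j
  ordered? : ∀ p → Dec (Ordered p)
  ordered? (i , j) = i Fin.<? j
  Active : Fin (k * k) → Set
  Active c = Ordered (remQuot k c)
  Through : Fin k × Fin k → Subset (length H)
  Through (i , j) = hits H (φ i) (φ j)
  enough : ∀ c → Active c → k * k ≤ ∣ Through (remQuot k c) ∣
  enough c i<j = heavy (proj₂ (proj₂ chosen) _) (proj₂ (proj₂ chosen) _) (Finₚ.<⇒≢ i<j ∘ φ-inj)
  open Representatives (greedy (k * k) (Through ∘ remQuot k) (ordered? ∘ remQuot k) enough)
  activeEdge : (e : Edge F) → Active (combine (proj₁ e) (proj₁ (proj₂ e)))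
  activeEdge (i , j , i<j , _) = subst Ordered (sym (Finₚ.remQuot-combine i j)) i<j
  f : Edge F → Fin (length H)
  f e = pick _ (activeEdge e)
  f-inj : Injective _≡_ _≡_ f
  f-inj {e} {e′} fe≡fe′ =
    let (i≡i′ , j≡j′) = Finₚ.combine-injective _ _ _ _ (distinct (activeEdge e) (activeEdge e′) fe≡fe′)
    in edge-≡ {F} e e′ i≡i′ j≡j′
  f-covers : (e : Edge F) → let (i , j , _) = e in
    (φ i ∈ List.lookup H (f e)) × (φ j ∈ List.lookup H (f e))
  f-covers e@(i , j , _) =
    hits-sound H (f e) (subst (λ p → f e ∈ Through p) (Finₚ.remQuot-combine i j) (pick∈ _ (activeEdge e)))

pairWeight : ∀ {n} → (Fin n → Fin n → ℕ) → Subset n → ℕ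
pairWeight w s = ∑ λ u → ∑ λ v → w u v * 𝟙 (bothIn? s u v)

pairWeight-sum : ∀ {n} (w : Fin n → Fin n → ℕ) (G : Hypergraph n) →
  sum (List.map (pairWeight w) G) ≡ ∑ λ u → ∑ λ v → w u v * codegree G u v
pairWeight-sum w [] = sym (∑-zero λ u → ∑-zero λ v → *-zeroʳ (w u v))
pairWeight-sum {n} w (h ∷ G) = begin
  pairWeight w h + sum (List.map (pairWeight w) G)
    ≡⟨ cong (pairWeight w h +_) (pairWeight-sum w G) ⟩
  pairWeight w h + (∑ λ u → ∑ λ v → w u v * codegree G u v)
    ≡⟨ sym (∑-distrib-+ (λ u → ∑ (inH u)) (λ u → ∑ (inG u))) ⟩
  (∑ λ u → ∑ (inH u) + ∑ (inG u))
    ≡⟨ sum-cong-≗ (λ u → sym (∑-distrib-+ (inH u) (inG u))) ⟩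
  (∑ λ u → ∑ λ v → w u v * 𝟙 (bothIn? h u v) + w u v * codegree G u v)
    ≡⟨ sum-cong-≗ (λ u → sum-cong-≗ (λ v → addHit u v)) ⟩
  (∑ λ u → ∑ λ v → w u v * codegree (h ∷ G) u v) ∎
  where
  open ≡-Reasoning
  inH : Fin n → Fin n → ℕ
  inH u v = w u v * 𝟙 (bothIn? h u v)
  inG : Fin n → Fin n → ℕ
  inG u v = w u v * codegree G u v
  addHit : ∀ u v → inH u v + inG u v ≡ w u v * codegree (h ∷ G) u v
  addHit u v = trans (sym (*-distribˡ-+ (w u v) _ _)) (cong (w u v *_) (sym (∣does∷p∣ (bothIn? h u v) (hits G u v))))

sum-map-≤ : ∀ {A : Set} (f g : A → ℕ) c {xs : List A} → All (λ x → f x ≤ c * g x) xs →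
  sum (List.map f xs) ≤ c * sum (List.map g xs)
sum-map-≤ f g c []               = z≤n
sum-map-≤ f g c {x ∷ xs} (fx≤ ∷ rest) = begin
  f x + sum (List.map f xs)         ≤⟨ +-mono-≤ fx≤ (sum-map-≤ f g c rest) ⟩
  c * g x + c * sum (List.map g xs) ≡⟨ sym (*-distribˡ-+ c (g x) _) ⟩
  c * (g x + sum (List.map g xs))   ∎
  where open ≤-Reasoning

scaleSquare : ∀ a m b → a * (m * (m * b)) ≡ (a * b) * (m * (m * 1))
scaleSquare = solve-∀

module LightPairs (F : Graph) {n : ℕ} (H : Hypergraph n) (free : Free H F) where

  k : ℕ
  k = vertices F

  Light : Fin n → Fin n → Set
  Light u v = u ≢ v × codegree H u v < k * k

  light? : ∀ u v → Dec (Light u v)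
  light? u v = ¬? (u Fin.≟ v) ×-dec (codegree H u v <? k * k)

  lightIn : Subset n → ℕ
  lightIn = pairWeight λ u v → 𝟙 (light? u v)

  lightPairIn : ∀ s → k ≤ ∣ s ∣ → ∃ λ u → ∃ λ v → Light u v × BothIn s u v
  lightPairIn s k≤∣s∣ with Finₚ.any? (λ u → Finₚ.any? (λ v → light? u v ×-dec bothIn? s u v))
  ... | yes found = found
  ... | no none   = contradiction (containsFromHeavySet F H s k≤∣s∣ heavy) free
    where
    heavy : ∀ {u v} → u ∈ s → v ∈ s → u ≢ v → k * k ≤ codegree H u v
    heavy {u} {v} u∈s v∈s u≢v = ≮⇒≥ λ small → none (u , v , (u≢v , small) , u∈s , v∈s)

  lightIn-remove : ∀ s {u v} → Light u v → BothIn s u v → lightIn (s - u) < lightIn s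
  lightIn-remove s {u} {v} uv-light uv∈s =
    ∑-mono-< (λ x → ∑-mono (term≤ x)) u (∑-mono-< (term≤ u) v lost)
    where
    term≤ : ∀ x y → 𝟙 (light? x y) * 𝟙 (bothIn? (s - u) x y) ≤ 𝟙 (light? x y) * 𝟙 (bothIn? s x y)
    term≤ x y = *-monoʳ-≤ (𝟙 (light? x y)) (𝟙-mono _ _ (Product.map (p─q⊆p s _) (p─q⊆p s _)))
    lost : 𝟙 (light? u v) * 𝟙 (bothIn? (s - u) u v) < 𝟙 (light? u v) * 𝟙 (bothIn? s u v)
    lost with light? u v | bothIn? (s - u) u v | bothIn? s u v
    ... | no ¬light | _             | _        = contradiction uv-light ¬light
    ... | yes _     | yes (u∈ , _) | _        = contradiction u∈ (x∉p-x s u)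
    ... | yes _     | no _          | no ¬both = contradiction uv∈s ¬both
    ... | yes _     | no _          | yes _    = s≤s z≤n

  sizeBound : ∀ s → ∣ s ∣ ≤ k + lightIn s
  sizeBound s = bounded ∣ s ∣ s ≤-refl
    where
    bounded : ∀ m s → ∣ s ∣ ≤ m → ∣ s ∣ ≤ k + lightIn s
    bounded zero    s ∣s∣≤0 = ≤-trans ∣s∣≤0 z≤n
    bounded (suc m) s ∣s∣≤m with k ≤? ∣ s ∣
    ... | no ∣s∣<k = ≤-trans (<⇒≤ (≰⇒> ∣s∣<k)) (m≤m+n k _)
    ... | yes k≤∣s∣ with lightPairIn s k≤∣s∣
    ... | u , v , uv-light , u∈s , v∈s = begin
      ∣ s ∣                     ≤⟨ ∣p∣≤1+∣p-x∣ s u ⟩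
      suc ∣ s - u ∣             ≤⟨ s≤s (bounded m (s - u) ∣s-u∣≤m) ⟩
      suc (k + lightIn (s - u)) ≡⟨ sym (+-suc k _) ⟩
      k + suc (lightIn (s - u)) ≤⟨ +-monoʳ-≤ k (lightIn-remove s uv-light (u∈s , v∈s)) ⟩
      k + lightIn s             ∎
      where
      open ≤-Reasoning
      ∣s-u∣≤m : ∣ s - u ∣ ≤ m
      ∣s-u∣≤m = ≤-pred (≤-trans (x∈p⇒∣p-x∣<∣p∣ u∈s) ∣s∣≤m)

  edgeBound : ∀ h → k ≤ ∣ h ∣ → ∣ h ∣ ≤ suc k * lightIn h
  edgeBound h k≤∣h∣ = begin
    ∣ h ∣                 ≤⟨ sizeBound h ⟩
    k + lightIn h         ≤⟨ +-monoˡ-≤ (lightIn h) k≤k*L ⟩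
    k * lightIn h + lightIn h ≡⟨ +-comm (k * lightIn h) _ ⟩
    suc k * lightIn h     ∎
    where
    open ≤-Reasoning
    L≥1 : 1 ≤ lightIn h
    L≥1 = let (u , v , uv-light , uv∈h) = lightPairIn h k≤∣h∣ in
          ≤-trans (s≤s z≤n) (lightIn-remove h uv-light uv∈h)
    k≤k*L : k ≤ k * lightIn h
    k≤k*L = ≤-trans (≤-reflexive (sym (*-identityʳ k))) (*-monoʳ-≤ k L≥1)

  -- Light pairs have codegree below k², and there are at most n² of them.
  totalSize-bound : All (λ h → k ≤ ∣ h ∣) H → totalSize H ≤ (suc k * (k * k)) * n ^ 2
  totalSize-bound big = begin
    totalSize H                        ≤⟨ sum-map-≤ ∣_∣ lightIn (suc k) (All.map (λ {h} → edgeBound h) big) ⟩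
    suc k * sum (List.map lightIn H)   ≡⟨ cong (suc k *_) (pairWeight-sum (λ u v → 𝟙 (light? u v)) H) ⟩
    suc k * (∑ λ u → ∑ λ v → 𝟙 (light? u v) * codegree H u v)
      ≤⟨ *-monoʳ-≤ (suc k) (∑-bound _ λ u → ∑-bound _ λ v → lightCodegree u v) ⟩
    suc k * (n * (n * (k * k)))        ≡⟨ scaleSquare (suc k) n (k * k) ⟩
    (suc k * (k * k)) * n ^ 2          ∎
    where
    open ≤-Reasoning
    lightCodegree : ∀ u v → 𝟙 (light? u v) * codegree H u v ≤ k * k
    lightCodegree u v with light? u v
    ... | yes (_ , small) = ≤-trans (≤-reflexive (*-identityˡ _)) (<⇒≤ small)
    ... | no _            = z≤n

∣p++q∣ : ∀ {m n} (p : Subset m) (q : Subset n) → ∣ p Vec.++ q ∣ ≡ ∣ p ∣ + ∣ q ∣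
∣p++q∣ []            q = refl
∣p++q∣ (inside  ∷ p) q = cong suc (∣p++q∣ p q)
∣p++q∣ (outside ∷ p) q = ∣p++q∣ p q

-- The graph {(s , c s)} of a function c : Fin r → Fin m, as a subset of
-- Fin r × Fin m ≅ Fin (r * m): one point in every row.
graphOf : ∀ {r m} → (Fin r → Fin m) → Subset (r * m)
graphOf c = Vec.concat (Vec.tabulate (⁅_⁆ ∘ c))

∣graphOf∣ : ∀ {r m} (c : Fin r → Fin m) → ∣ graphOf c ∣ ≡ r
∣graphOf∣ {zero}  c = refl
∣graphOf∣ {suc r} c = begin
  ∣ ⁅ c zero ⁆ Vec.++ graphOf (c ∘ suc) ∣ ≡⟨ ∣p++q∣ ⁅ c zero ⁆ (graphOf (c ∘ suc)) ⟩
  ∣ ⁅ c zero ⁆ ∣ + ∣ graphOf (c ∘ suc) ∣ ≡⟨ cong₂ _+_ (∣⁅x⁆∣≡1 (c zero)) (∣graphOf∣ (c ∘ suc)) ⟩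
  suc r                                   ∎
  where open ≡-Reasoning

graphOf-member : ∀ {r m} (c : Fin r → Fin m) s i → combine s i ∈ graphOf c → i ≡ c s
graphOf-member c s i si∈ = x∈⁅y⁆⇒x≡y (c s) (lookup⇒[]= i ⁅ c s ⁆ (begin
  Vec.lookup ⁅ c s ⁆ i                                  ≡⟨ cong (λ row → Vec.lookup row i) (lookup∘tabulate (⁅_⁆ ∘ c) s) ⟨
  Vec.lookup (Vec.lookup (Vec.tabulate (⁅_⁆ ∘ c)) s) i  ≡⟨ lookup-concat (Vec.tabulate (⁅_⁆ ∘ c)) s i ⟨
  Vec.lookup (graphOf c) (combine s i)                  ≡⟨ []=⇒lookup si∈ ⟩
  inside                                                ∎))
  where open ≡-Reasoning

ends : ∀ {G} → Edge G → Fin (vertices G) × Fin (vertices G)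
ends (i , j , _) = i , j

K-adjacent : ∀ {r} {κ μ : Fin r} → κ ≢ μ → T (adj (K r) κ μ)
K-adjacent {κ = κ} {μ} κ≢μ with κ Fin.≟ μ
... | yes κ≡μ = contradiction κ≡μ κ≢μ
... | no _    = tt

edgeOf : ∀ {r} {κ μ : Fin r} → κ ≢ μ → Edge (K r)
edgeOf {κ = κ} {μ} κ≢μ with Finₚ.<-cmp κ μ
... | tri< κ<μ _ _ = κ , μ , κ<μ , K-adjacent κ≢μ
... | tri≈ _ κ≡μ _ = contradiction κ≡μ κ≢μ
... | tri> _ _ μ<κ = μ , κ , μ<κ , K-adjacent (κ≢μ ∘ sym)

edgeOf-ends : ∀ {r} {κ μ : Fin r} (κ≢μ : κ ≢ μ) →
  ends {K r} (edgeOf κ≢μ) ≡ (κ , μ) ⊎ ends {K r} (edgeOf κ≢μ) ≡ (μ , κ)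
edgeOf-ends {κ = κ} {μ} κ≢μ with Finₚ.<-cmp κ μ
... | tri< _ _ _   = inj₁ refl
... | tri≈ _ κ≡μ _ = contradiction κ≡μ κ≢μ
... | tri> _ _ _   = inj₂ refl

other-≡ : ∀ {A : Set} {p q : A × A} {κ μ ν : A} → κ ≢ μ → κ ≢ ν →
  p ≡ (κ , μ) ⊎ p ≡ (μ , κ) → q ≡ (κ , ν) ⊎ q ≡ (ν , κ) → p ≡ q → μ ≡ ν
other-≡ _   _   (inj₁ refl) (inj₁ refl) refl = refl
other-≡ _   κ≢ν (inj₁ refl) (inj₂ refl) refl = contradiction refl κ≢ν
other-≡ κ≢μ _   (inj₂ refl) (inj₁ refl) refl = contradiction refl κ≢μ
other-≡ _   _   (inj₂ refl) (inj₂ refl) refl = refl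

module BergeClique {n r} {H : Hypergraph n} (copy : Contains H (K r)) where

  φ : Fin r → Fin n
  φ = proj₁ copy

  φ-inj : Injective _≡_ _≡_ φ
  φ-inj = proj₁ (proj₂ (proj₂ copy))

  link : ∀ {κ μ} → κ ≢ μ → Fin (length H)
  link κ≢μ = proj₁ (proj₂ copy) (edgeOf κ≢μ)

  link-covers : ∀ {κ μ} (κ≢μ : κ ≢ μ) →
    φ κ ∈ List.lookup H (link κ≢μ) × φ μ ∈ List.lookup H (link κ≢μ)
  link-covers κ≢μ =
    [ (λ fwd → subst Covered fwd covered) , (λ bwd → Product.swap (subst Covered bwd covered)) ]′
      (edgeOf-ends κ≢μ)
    where
    Covered : Fin r × Fin r → Set
    Covered (a , b) = φ a ∈ List.lookup H (link κ≢μ) × φ b ∈ List.lookup H (link κ≢μ)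
    covered : Covered (ends {K r} (edgeOf κ≢μ))
    covered = proj₂ (proj₂ (proj₂ (proj₂ copy))) (edgeOf κ≢μ)

  link-injective : ∀ {κ μ ν} (κ≢μ : κ ≢ μ) (κ≢ν : κ ≢ ν) → link κ≢μ ≡ link κ≢ν → μ ≡ ν
  link-injective κ≢μ κ≢ν same = other-≡ κ≢μ κ≢ν (edgeOf-ends κ≢μ) (edgeOf-ends κ≢ν)
    (cong (ends {K r}) (proj₁ (proj₂ (proj₂ (proj₂ copy))) same))

remQuot-injective : ∀ {r} m {v w : Fin (r * m)} → remQuot {r} m v ≡ remQuot m w → v ≡ w
remQuot-injective {r} m {v} {w} same = begin
  v                                ≡⟨ Finₚ.combine-remQuot {r} m v ⟨
  Product.uncurry combine (remQuot {r} m v) ≡⟨ cong (Product.uncurry combine) same ⟩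
  Product.uncurry combine (remQuot {r} m w) ≡⟨ Finₚ.combine-remQuot {r} m w ⟩
  w                                ∎
  where open ≡-Reasoning

lookup-tabulate′ : ∀ {A : Set} {n} (f : Fin n → A) x →
  List.lookup (List.tabulate f) x ≡ f (Fin.cast (length-tabulate f) x)
lookup-tabulate′ f x = trans (cong (List.lookup (List.tabulate f)) (sym (Finₚ.cast-involutive (sym (length-tabulate f)) (length-tabulate f) x)))
                             (lookup-tabulate f (Fin.cast (length-tabulate f) x))

cast-injective : ∀ {m n} (eq : m ≡ n) {x y : Fin m} → Fin.cast eq x ≡ Fin.cast eq y → x ≡ y
cast-injective eq {x} {y} same = begin
  x                            ≡⟨ Finₚ.cast-involutive (sym eq) eq x ⟨
  Fin.cast (sym eq) (Fin.cast eq x) ≡⟨ cong (Fin.cast (sym eq)) same ⟩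
  Fin.cast (sym eq) (Fin.cast eq y) ≡⟨ Finₚ.cast-involutive (sym eq) eq y ⟩
  y                            ∎
  where open ≡-Reasoning

totalSize-uniform : ∀ {n r} (H : Hypergraph n) → All (λ h → ∣ h ∣ ≡ r) H → totalSize H ≡ length H * r
totalSize-uniform []      []           = refl
totalSize-uniform (h ∷ H) (∣h∣≡r ∷ rest) = cong₂ _+_ ∣h∣≡r (totalSize-uniform H rest)

twoDistinct : ∀ {d} → 2 ≤ d → Σ (Fin d) λ x → Σ (Fin d) λ y → x ≢ y
twoDistinct (s≤s (s≤s _)) = zero , suc zero , λ ()

-- The star-block hypergraph: vertices are the points (s , i) of an r × m grid
-- (r = d + 1), level 0 being the apex row.  For every pair (a , j) there is a
-- hyperedge consisting of the apex (0 , a) and the column j of all other levels.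
module StarBlocks (d m : ℕ) where

  r : ℕ
  r = suc d

  N : ℕ
  N = r * m

  column : Fin m × Fin m → Fin r → Fin m
  column (a , _) zero    = a
  column (_ , j) (suc _) = j

  column-apex : ∀ aj {s} → s ≡ zero → column aj s ≡ proj₁ aj
  column-apex aj refl = refl

  column-body : ∀ aj {s} → s ≢ zero → column aj s ≡ proj₂ aj
  column-body aj {zero}  s≢0 = contradiction refl s≢0
  column-body aj {suc _} _   = refl

  block : Fin m × Fin m → Subset N
  block aj = graphOf (column aj)

  blocks : Hypergraph N
  blocks = List.tabulate (block ∘ remQuot m)

  params : Fin (length blocks) → Fin m × Fin m
  params x = remQuot m (Fin.cast (length-tabulate (block ∘ remQuot m)) x)

  params-injective : ∀ {x y} → params x ≡ params y → x ≡ y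
  params-injective = cast-injective (length-tabulate (block ∘ remQuot m)) ∘ remQuot-injective m

  lookup-blocks : ∀ x → List.lookup blocks x ≡ block (params x)
  lookup-blocks = lookup-tabulate′ (block ∘ remQuot m)

  blocks-uniform : All (λ h → ∣ h ∣ ≡ r) blocks
  blocks-uniform = tabulate⁺ (λ x → ∣graphOf∣ (column (remQuot m x)))

  totalSize-blocks : totalSize blocks ≡ (m * m) * r
  totalSize-blocks = trans (totalSize-uniform blocks blocks-uniform)
                           (cong (_* r) (length-tabulate (block ∘ remQuot m)))


  module Placed (copy : Contains blocks (K r)) where

    open BergeClique {H = blocks} copy public

    level : Fin r → Fin r
    level κ = proj₁ (remQuot {r} m (φ κ))

    col : Fin r → Fin m
    col κ = proj₂ (remQuot {r} m (φ κ))

    same-place : ∀ {κ μ} → level κ ≡ level μ → col κ ≡ col μ → κ ≡ μ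
    same-place same-level same-col = φ-inj (remQuot-injective {r} m (cong₂ _,_ same-level same-col))

    onBlock : ∀ κ x → φ κ ∈ List.lookup blocks x → col κ ≡ column (params x) (level κ)
    onBlock κ x κ∈x = graphOf-member (column (params x)) (level κ) (col κ)
      (subst (_∈ block (params x)) (sym (Finₚ.combine-remQuot {r} m (φ κ)))
        (subst (φ κ ∈_) (lookup-blocks x) κ∈x))

    onLink : ∀ {κ μ} (κ≢μ : κ ≢ μ) → let aj = params (link κ≢μ) in
      col κ ≡ column aj (level κ) × col μ ≡ column aj (level μ)
    onLink κ≢μ = Product.map (onBlock _ _) (onBlock _ _) (link-covers κ≢μ)

    -- A hyperedge meets the apex row once, so the clique has at most one apex.
    atMostOneApex : ∀ {κ μ} → κ ≢ μ → level κ ≡ zero → level μ ≡ zero → ⊥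
    atMostOneApex {κ} {μ} κ≢μ κ-apex μ-apex = κ≢μ (same-place same-level (begin
      col κ                   ≡⟨ proj₁ (onLink κ≢μ) ⟩
      column aj (level κ)     ≡⟨ column-apex aj κ-apex ⟩
      proj₁ aj                ≡⟨ column-apex aj μ-apex ⟨
      column aj (level μ)     ≡⟨ proj₂ (onLink κ≢μ) ⟨
      col μ                   ∎))
      where
      open ≡-Reasoning
      aj = params (link κ≢μ)
      same-level = trans κ-apex (sym μ-apex)

    -- Outside the apex row a hyperedge is a single column.
    bodiesAligned : ∀ {κ μ} → κ ≢ μ → level κ ≢ zero → level μ ≢ zero → col κ ≡ col μ
    bodiesAligned {κ} {μ} κ≢μ κ-body μ-body = begin
      col κ                   ≡⟨ proj₁ (onLink κ≢μ) ⟩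
      column aj (level κ)     ≡⟨ column-body aj κ-body ⟩
      proj₂ aj                ≡⟨ column-body aj μ-body ⟨
      column aj (level μ)     ≡⟨ proj₂ (onLink κ≢μ) ⟨
      col μ                   ∎
      where
      open ≡-Reasoning
      aj = params (link κ≢μ)

    -- Without an apex, r vertices share one column on only d levels.
    noApex-impossible : (∀ κ → level κ ≢ zero) → ⊥
    noApex-impossible body =
      let (κ , μ , κ<μ , same) = Finₚ.pigeonhole (n<1+n d) bodyLevel
          κ≢μ = Finₚ.<⇒≢ κ<μ
      in κ≢μ (same-place (Finₚ.punchOut-injective (body κ ∘ sym) (body μ ∘ sym) same)
                         (bodiesAligned κ≢μ (body κ) (body μ)))
      where
      bodyLevel : Fin r → Fin d
      bodyLevel κ = Fin.punchOut (body κ ∘ sym)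

    -- With an apex κ₀ and two further vertices κ₁ κ₂ (both in the body), the
    -- links κ₀κ₁ and κ₀κ₂ have equal parameters, hence coincide.
    apex-impossible : 2 ≤ d → ∀ κ₀ → level κ₀ ≡ zero → ⊥
    apex-impossible 2≤d κ₀ κ₀-apex = κ₁≢κ₂ (link-injective κ₀≢κ₁ κ₀≢κ₂ (params-injective (cong₂ _,_ same-apex same-column)))
      where
      open ≡-Reasoning
      two : Σ (Fin d) λ x → Σ (Fin d) λ y → x ≢ y
      two = twoDistinct 2≤d
      κ₁ κ₂ : Fin r
      κ₁ = Fin.punchIn κ₀ (proj₁ two)
      κ₂ = Fin.punchIn κ₀ (proj₁ (proj₂ two))
      κ₀≢κ₁ : κ₀ ≢ κ₁
      κ₀≢κ₁ = Finₚ.punchInᵢ≢i κ₀ _ ∘ sym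
      κ₀≢κ₂ : κ₀ ≢ κ₂
      κ₀≢κ₂ = Finₚ.punchInᵢ≢i κ₀ _ ∘ sym
      κ₁≢κ₂ : κ₁ ≢ κ₂
      κ₁≢κ₂ = proj₂ (proj₂ two) ∘ Finₚ.punchIn-injective κ₀ _ _
      P₁ P₂ : Fin m × Fin m
      P₁ = params (link κ₀≢κ₁)
      P₂ = params (link κ₀≢κ₂)
      same-apex : proj₁ P₁ ≡ proj₁ P₂
      same-apex = begin
        proj₁ P₁            ≡⟨ column-apex P₁ κ₀-apex ⟨
        column P₁ (level κ₀) ≡⟨ proj₁ (onLink κ₀≢κ₁) ⟨
        col κ₀              ≡⟨ proj₁ (onLink κ₀≢κ₂) ⟩
        column P₂ (level κ₀) ≡⟨ column-apex P₂ κ₀-apex ⟩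
        proj₁ P₂            ∎
      κ₁-body : level κ₁ ≢ zero
      κ₁-body = atMostOneApex κ₀≢κ₁ κ₀-apex
      κ₂-body : level κ₂ ≢ zero
      κ₂-body = atMostOneApex κ₀≢κ₂ κ₀-apex
      same-column : proj₂ P₁ ≡ proj₂ P₂
      same-column = begin
        proj₂ P₁            ≡⟨ column-body P₁ κ₁-body ⟨
        column P₁ (level κ₁) ≡⟨ proj₂ (onLink κ₀≢κ₁) ⟨
        col κ₁              ≡⟨ bodiesAligned κ₁≢κ₂ κ₁-body κ₂-body ⟩
        col κ₂              ≡⟨ proj₂ (onLink κ₀≢κ₂) ⟩
        column P₂ (level κ₂) ≡⟨ column-body P₂ κ₂-body ⟩
        proj₂ P₂            ∎

    impossible : 2 ≤ d → ⊥
    impossible 2≤d with Finₚ.any? (λ κ → level κ Fin.≟ zero)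
    ... | yes (κ₀ , apex) = apex-impossible 2≤d κ₀ apex
    ... | no noApex       = noApex-impossible (λ κ apex → noApex (κ , apex))

  blocks-free : 2 ≤ d → Free blocks (K r)
  blocks-free 2≤d copy = Placed.impossible copy 2≤d

  -- N² = r · totalSize: the density constant is 1/r.
  dense : 1 * N ^ 2 ≤ r * totalSize blocks
  dense = ≤-reflexive (trans (square r m) (cong (r *_) (sym totalSize-blocks)))
    where
    square : ∀ r m → 1 * ((r * m) * ((r * m) * 1)) ≡ r * ((m * m) * r)
    square = solve-∀

theorem3 :
    ((F : Graph) → ∃ λ (C : ℕ) →
      ∀ (n : ℕ) (H : Hypergraph n) → Free H F →
        All (λ h → vertices F ≤ ∣ h ∣) H →
        totalSize H ≤ C * n ^ 2)
    ×
    ((r : ℕ) → 3 ≤ r →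
      -- the constant c = (suc p) / (suc q) > 0
      ∃ λ (p : ℕ) → ∃ λ (q : ℕ) →
        ∀ (M : ℕ) → ∃ λ (N : ℕ) → M ≤ N × Σ (Hypergraph N) λ H →
          Free H (K r) × All (λ h → ∣ h ∣ ≡ r) H ×
          suc p * N ^ 2 ≤ suc q * totalSize H)
theorem3 =
  (λ F → let k = vertices F in
     suc k * (k * k) , λ n H free big → LightPairs.totalSize-bound F H free big) ,
  λ where
    (suc d) (s≤s 2≤d) → 0 , d , λ M → let open StarBlocks d M in
      N , m≤n*m M r , blocks , blocks-free 2≤d , blocks-uniform , dense
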